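{- Consider the single-process architecture with set of input propositions $I=\emptyset$ and set of output propositions $O=\{o\}$. There exists a $\mathrm{PROMPT}$-$\mathrm{LTL}$ assume-guarantee specification $\langle\varphi,\psi\rangle$ over $\{o\}$ that is realized by some infinite-state strategy, but is not realized by any finite-state strategy.
   Context: $\mathrm{PROMPT}$-$\mathrm{LTL}$ formulas are $\mathrm{LTL}$ formulas in negation normal form (built from atomic propositions and their negations using $\wedge,\vee,\mathbf{X},\mathbf{U},\mathbf{R}$, with derived $\mathbf{F},\mathbf{G}$) extended by the prompt-eventually operator $\mathbf{F}_p$. A formula is evaluated on a word $w\in(2^{AP})^\omega$ with respect to a bound $k\in\mathbb{N}$: all $\mathrm{LTL}$ operators have their usual semantics, and $(w,i,k)\models\mathbf{F}_p\chi$ iff there is $j$ with $i\le j\le i+k$ and $(w,j,k)\models\chi$; $(w,k)\models\chi$ means $(w,0,k)\models\chi$. A strategy for a single process with inputs $I$ and outputs $O$ is a function $f:(2^I)^*\to 2^O$; it is finite-state if it is generated by a finite transition system, and infinite-state otherwise. Each input sequence determines a computation $w\in(2^{I\cup O})^\omega$ of $f$. A strategy $f$ realizes (satisfies) the assume-guarantee specification $\langle\varphi,\psi\rangle$ (a pair of $\mathrm{PROMPT}$-$\mathrm{LTL}$ formulas) if for every bound $k$ there is a bound $l$ such that for every computation $w$ of $f$, $(w,k)\models\varphi$ implies $(w,l)\models\psi$. -}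

module Defs where

open import Data.Nat using (ℕ; zero; suc; _+_; _≤_; _<_)
open import Data.Bool using (Bool; true; false)
open import Data.Fin using (Fin)
open import Data.List using (List; []; _∷_; _∷ʳ_; foldl)
open import Data.Sum using (_⊎_; inj₁; inj₂)
open import Data.Product using (Σ; ∃; _×_; _,_)
open import Data.Empty using (⊥)
open import Data.Unit using (⊤)
open import Relation.Nullary using (¬_)
open import Relation.Binary.PropositionalEquality using (_≡_)

data Formula (AP : Set) : Set where
  atom  : AP → Formula AP
  natom : AP → Formula AP
  _∧'_  : Formula AP → Formula AP → Formula AP
  _∨'_  : Formula AP → Formula AP → Formula AP
  X     : Formula AP → Formula AP
  _U_   : Formula AP → Formula AP → Formula AP
  _R_   : Formula AP → Formula AP → Formula AP
  Fp    : Formula AP → Formula AP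

Word : Set → Set
Word AP = ℕ → (AP → Bool)

Sat : {AP : Set} → Word AP → ℕ → ℕ → Formula AP → Set
Sat w i k (atom p)  = w i p ≡ true
Sat w i k (natom p) = w i p ≡ false
Sat w i k (φ ∧' ψ)  = Sat w i k φ × Sat w i k ψ
Sat w i k (φ ∨' ψ)  = Sat w i k φ ⊎ Sat w i k ψ
Sat w i k (X φ)     = Sat w (suc i) k φ
Sat w i k (φ U ψ)   =
  Σ ℕ λ j → i ≤ j × Sat w j k ψ × (∀ m → i ≤ m → m < j → Sat w m k φ)
Sat w i k (φ R ψ)   =
  ∀ j → i ≤ j → Sat w j k ψ ⊎ (Σ ℕ λ m → i ≤ m × m < j × Sat w m k φ)
Sat w i k (Fp φ)    = Σ ℕ λ j → i ≤ j × j ≤ i + k × Sat w j k φ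

_,_⊨_ : {AP : Set} → Word AP → ℕ → Formula AP → Set
w , k ⊨ φ = Sat w 0 k φ

AP : Set → Set → Set
AP I O = I ⊎ O

Strategy : Set → Set → Set
Strategy I O = List (I → Bool) → (O → Bool)

prefix : {A : Set} → (ℕ → A) → ℕ → List A
prefix x zero    = []
prefix x (suc n) = prefix x n ∷ʳ x n

computation : {I O : Set} → Strategy I O → (ℕ → (I → Bool)) → Word (AP I O)
computation f x n (inj₁ i) = x n i
computation f x n (inj₂ o) = f (prefix x n) o

IsComputation : {I O : Set} → Strategy I O → Word (AP I O) → Set
IsComputation {I} f w = Σ (ℕ → (I → Bool)) λ x → ∀ n a → w n a ≡ computation f x n a

Realizes : {I O : Set} → Strategy I O → Formula (AP I O) → Formula (AP I O) → Set
Realizes f φ ψ =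
  ∀ (k : ℕ) → Σ ℕ λ l → ∀ w → IsComputation f w → w , k ⊨ φ → w , l ⊨ ψ

record FiniteTS (I O : Set) : Set where
  field
    size  : ℕ
    init  : Fin size
    δ     : Fin size → (I → Bool) → Fin size
    out   : Fin size → (O → Bool)

run : {I O : Set} → (T : FiniteTS I O) → List (I → Bool) → Fin (FiniteTS.size T)
run T xs = foldl (FiniteTS.δ T) (FiniteTS.init T) xs

Generates : {I O : Set} → FiniteTS I O → Strategy I O → Set
Generates T f = ∀ xs o → f xs o ≡ FiniteTS.out T (run T xs) o

IsFiniteState : {I O : Set} → Strategy I O → Set
IsFiniteState {I} {O} f = Σ (FiniteTS I O) λ T → Generates T f

IsInfiniteState : {I O : Set} → Strategy I O → Set
IsInfiniteState f = ¬ IsFiniteState f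

Iₐ : Set
Iₐ = ⊥

Oₐ : Set
Oₐ = ⊤

module Submission where

-- Let φ = G (Fp o) ∨ F (G ¬o) and ψ = false.  A strategy realizes ⟨φ, ψ⟩
-- iff, for every bound k, none of its computations satisfies φ with bound
-- k; and a word satisfies φ with some bound iff its o-stream either has
-- bounded gaps between occurrences of o or is eventually false.
--
-- Finite-state side: on a constant input a finite transition system runs
-- through a sequence of states that repeats (pigeonhole), so the o-stream is
-- eventually periodic; an eventually periodic Boolean stream has bounded
-- gaps or is eventually false.
-- Infinite-state side: the strategy emitting o exactly at the times
-- 0, 2, 5, 9, 14, … (gaps 2, 3, 4, …) has infinitely many o's and
-- arbitrarily long o-free stretches, so it realizes ⟨φ, ψ⟩; by the
-- finite-state side it is not finite-state.

open import Defs
open import Data.Bool using (Bool; true; false)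
open import Data.Bool.Properties using (¬-not) renaming (_≟_ to _≟ᵇ_)
open import Data.Empty using (⊥-elim)
open import Data.Fin using (Fin; toℕ)
open import Data.Fin.Properties using (pigeonhole)
open import Data.List using (length)
open import Data.List.Properties using (foldl-∷ʳ; length-++)
open import Data.Nat using (ℕ; zero; suc; _+_; _*_; _∸_; _≤_; _<_; z≤n; s≤s)
open import Data.Nat.DivMod using (_%_; _/_; m≡m%n+[m/n]*n; m%n<n)
open import Data.Nat.Properties
open import Data.Nat.Tactic.RingSolver using (solve-∀)
open import Data.Product using (Σ; _×_; _,_)
open import Data.Sum using (_⊎_; inj₁; inj₂)
open import Data.Unit using (tt)
open import Relation.Nullary using (¬_; yes; no)
open import Relation.Binary.PropositionalEquality

module Derived {A : Set} (p : A) where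

  ⊤F ⊥F : Formula A
  ⊤F = atom p ∨' natom p
  ⊥F = atom p ∧' natom p

  G F : Formula A → Formula A
  G φ = ⊥F R φ
  F φ = ⊤F U φ

  ⊥F-unsat : ∀ (w : Word A) i k → ¬ Sat w i k ⊥F
  ⊥F-unsat w i k (holds , fails) with trans (sym holds) fails
  ... | ()

  ⊤F-sat : ∀ (w : Word A) i k → Sat w i k ⊤F
  ⊤F-sat w i k with w i p
  ... | true  = inj₁ refl
  ... | false = inj₂ refl

  G-sat : ∀ w {i} k φ → Sat w i k (G φ) → ∀ j → i ≤ j → Sat w j k φ
  G-sat w k φ always j i≤j with always j i≤j
  ... | inj₁ φj               = φj
  ... | inj₂ (m , _ , _ , ⊥m) = ⊥-elim (⊥F-unsat w m k ⊥m)

  sat-G : ∀ w {i} k φ → (∀ j → i ≤ j → Sat w j k φ) → Sat w i k (G φ)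
  sat-G w k φ φ-from-i j i≤j = inj₁ (φ-from-i j i≤j)

  F-sat : ∀ w {i} k φ → Sat w i k (F φ) → Σ ℕ λ j → i ≤ j × Sat w j k φ
  F-sat w k φ (j , i≤j , φj , _) = j , i≤j , φj

  sat-F : ∀ w {i j} k φ → i ≤ j → Sat w j k φ → Sat w i k (F φ)
  sat-F w {j = j} k φ i≤j φj = j , i≤j , φj , λ m _ _ → ⊤F-sat w m k

module GuaranteeFalse {I O : Set} (p : AP I O) where
  open Derived p

  realizes-⊥F : ∀ (f : Strategy I O) φ →
    (∀ k w → IsComputation f w → ¬ w , k ⊨ φ) → Realizes f φ ⊥F
  realizes-⊥F f φ never k = 0 , λ w c sat → ⊥-elim (never k w c sat)

  not-realizes-⊥F : ∀ (f : Strategy I O) φ k w →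
    IsComputation f w → w , k ⊨ φ → ¬ Realizes f φ ⊥F
  not-realizes-⊥F f φ k w c sat realizes with realizes k
  ... | l , guarantee = ⊥F-unsat w 0 l (guarantee w c sat)

BoundedGaps : ℕ → (ℕ → Bool) → Set
BoundedGaps k s = ∀ i → Σ ℕ λ j → i ≤ j × j ≤ i + k × s j ≡ true

EventuallyFalse : (ℕ → Bool) → Set
EventuallyFalse s = Σ ℕ λ a → ∀ n → a ≤ n → s n ≡ false

Sparse : (ℕ → Bool) → Set
Sparse s = (∀ i → Σ ℕ λ j → i ≤ j × s j ≡ true)
         × (∀ k → Σ ℕ λ i → ∀ d → d ≤ k → s (i + d) ≡ false)

Sparse-resp : ∀ {s t : ℕ → Bool} → (∀ n → s n ≡ t n) → Sparse s → Sparse t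
Sparse-resp s≗t (often , gaps) =
    (λ i → let (j , i≤j , sj) = often i in j , i≤j , trans (sym (s≗t j)) sj)
  , (λ k → let (i , gap) = gaps k in i , λ d d≤k → trans (sym (s≗t _)) (gap d d≤k))

-- A sparse stream neither has bounded gaps (a false stretch of length k + 1
-- defeats the bound k) nor is eventually false (a later true time defeats it).
Sparse-excludes : ∀ {s} k → Sparse s → ¬ (BoundedGaps k s ⊎ EventuallyFalse s)
Sparse-excludes k (_ , gaps) (inj₁ bounded) with gaps k
... | i , gap with bounded i
... | j , i≤j , j≤i+k , sj with m≤n⇒∃[o]m+o≡n i≤j
... | d , refl with trans (sym sj) (gap d (+-cancelˡ-≤ i d k j≤i+k))
... | ()
Sparse-excludes k (often , _) (inj₂ (a , false-from-a)) with often a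
... | j , a≤j , sj with trans (sym sj) (false-from-a j a≤j)
... | ()

Aₒ : Set
Aₒ = AP Iₐ Oₐ

o : Aₒ
o = inj₂ tt

open Derived o
open GuaranteeFalse o

φₒ : Formula Aₒ
φₒ = G (Fp (atom o)) ∨' F (G (natom o))

oStream : Word Aₒ → ℕ → Bool
oStream w n = w n o

φₒ-sat : ∀ w k → w , k ⊨ φₒ → BoundedGaps k (oStream w) ⊎ EventuallyFalse (oStream w)
φₒ-sat w k (inj₁ always-soon) = inj₁ λ i → G-sat w k (Fp (atom o)) always-soon i z≤n
φₒ-sat w k (inj₂ eventually) with F-sat w k (G (natom o)) eventually
... | a , _ , never-o = inj₂ (a , G-sat w k (natom o) never-o)

sat-φₒ : ∀ w k → BoundedGaps k (oStream w) ⊎ EventuallyFalse (oStream w) → w , k ⊨ φₒ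
sat-φₒ w k (inj₁ bounded) = inj₁ (sat-G w k (Fp (atom o)) λ i _ → bounded i)
sat-φₒ w k (inj₂ (a , false-from)) =
  inj₂ (sat-F w k (G (natom o)) z≤n (sat-G w k (natom o) false-from))

PeriodicFrom : {S : Set} → ℕ → ℕ → (ℕ → S) → Set
PeriodicFrom a p σ = ∀ n → a ≤ n → σ (n + suc p) ≡ σ n

EventuallyPeriodic : {S : Set} → (ℕ → S) → Set
EventuallyPeriodic σ = Σ ℕ λ a → Σ ℕ λ p → PeriodicFrom a p σ

periodic-map : ∀ {S T : Set} {σ : ℕ → S} {τ : ℕ → T} (g : S → T) →
  (∀ n → τ n ≡ g (σ n)) → EventuallyPeriodic σ → EventuallyPeriodic τ
periodic-map g τ≗gσ (a , p , periodic) = a , p , λ n a≤n →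
  trans (τ≗gσ _) (trans (cong g (periodic n a≤n)) (sym (τ≗gσ n)))

periodic-multiple : ∀ {S : Set} {σ : ℕ → S} {a p} → PeriodicFrom a p σ →
  ∀ q n → a ≤ n → σ (n + q * suc p) ≡ σ n
periodic-multiple {σ = σ} periodic zero n a≤n = cong σ (+-identityʳ n)
periodic-multiple {σ = σ} {a} {p} periodic (suc q) n a≤n = begin
  σ (n + (suc p + q * suc p))  ≡⟨ cong σ (rearrange n p (q * suc p)) ⟩
  σ (n + q * suc p + suc p)    ≡⟨ periodic _ (≤-trans a≤n (m≤m+n n _)) ⟩
  σ (n + q * suc p)            ≡⟨ periodic-multiple periodic q n a≤n ⟩
  σ n                          ∎
  where
  open ≡-Reasoning
  rearrange : ∀ n p m → n + (suc p + m) ≡ n + m + suc p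
  rearrange = solve-∀

-- A deterministic autonomous system with finitely many states is
-- eventually periodic: by pigeonhole two of the first N+1 states agree,
-- and from then on the runs coincide.
autonomous-periodic : ∀ {N} (σ : ℕ → Fin N) (step : Fin N → Fin N) →
  (∀ n → σ (suc n) ≡ step (σ n)) → EventuallyPeriodic σ
autonomous-periodic {N} σ step σ-step
  with pigeonhole (n<1+n N) (λ i → σ (toℕ i))
... | i , j , i<j , σi≡σj with m≤n⇒∃[o]m+o≡n i<j
... | p , i+1+p≡j = toℕ i , p , periodic
  where
  open ≡-Reasoning
  shift : ∀ {u v} m → σ u ≡ σ v → σ (m + u) ≡ σ (m + v)
  shift zero    eq = eq
  shift (suc m) eq =
    trans (σ-step _) (trans (cong step (shift m eq)) (sym (σ-step _)))

  periodic : PeriodicFrom (toℕ i) p σ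
  periodic n i≤n = begin
    σ (n + suc p)                 ≡⟨ cong σ (rearrange n (toℕ i) p i≤n) ⟩
    σ ((n ∸ toℕ i) + (suc (toℕ i) + p))
      ≡⟨ cong (λ t → σ ((n ∸ toℕ i) + t)) i+1+p≡j ⟩
    σ ((n ∸ toℕ i) + toℕ j)       ≡⟨ shift (n ∸ toℕ i) (sym σi≡σj) ⟩
    σ ((n ∸ toℕ i) + toℕ i)       ≡⟨ cong σ (m∸n+n≡m i≤n) ⟩
    σ n                           ∎
    where
    rearrange : ∀ n a p → a ≤ n → n + suc p ≡ (n ∸ a) + (suc a + p)
    rearrange n a p a≤n = begin
      n + suc p              ≡⟨ cong (_+ suc p) (sym (m∸n+n≡m a≤n)) ⟩
      (n ∸ a) + a + suc p    ≡⟨ regroup (n ∸ a) a p ⟩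
      (n ∸ a) + (suc a + p)  ∎
      where
      regroup : ∀ m a p → m + a + suc p ≡ m + (suc a + p)
      regroup = solve-∀

-- If some time t ≥ a is true, then every window of length t + suc p + 1
-- contains a true time: a true time j ≥ a reached from below stays usable
-- until it is passed, and then j + suc p is true again.
periodic-bounded : ∀ {s : ℕ → Bool} {a p t} → PeriodicFrom a p s →
  a ≤ t → s t ≡ true → BoundedGaps (t + suc p) s
periodic-bounded {s} {a} {p} {t} periodic a≤t st i =
  let (j , i≤j , j≤i+K , _ , sj) = witness i in j , i≤j , j≤i+K , sj
  where
  K = t + suc p
  witness : ∀ i → Σ ℕ λ j → i ≤ j × j ≤ i + K × a ≤ j × s j ≡ true
  witness zero = t , z≤n , m≤m+n t (suc p) , a≤t , st
  witness (suc i) with witness i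
  ... | j , i≤j , j≤i+K , a≤j , sj with m≤n⇒m<n∨m≡n i≤j
  ...   | inj₁ i<j  = j , i<j , m≤n⇒m≤1+n j≤i+K , a≤j , sj
  ...   | inj₂ refl =
      j + suc p , m<m+n j (s≤s z≤n) , m≤n⇒m≤1+n (+-monoʳ-≤ j (m≤n+m (suc p) t))
    , ≤-trans a≤j (m≤m+n j (suc p)) , trans (periodic j a≤j) sj

-- If the first period [a, a + suc p) is false, the stream is false from a on:
-- every later time is congruent to one of them modulo the period.
periodic-false : ∀ {s : ℕ → Bool} {a p} → PeriodicFrom a p s →
  (∀ d → d < suc p → s (a + d) ≡ false) → ∀ n → a ≤ n → s n ≡ false
periodic-false {s} {a} {p} periodic first-period n a≤n = begin
  s n                    ≡⟨ cong s decompose ⟩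
  s (a + r + q * suc p)  ≡⟨ periodic-multiple periodic q (a + r) (m≤m+n a r) ⟩
  s (a + r)              ≡⟨ first-period r (m%n<n (n ∸ a) (suc p)) ⟩
  false                  ∎
  where
  open ≡-Reasoning
  r = (n ∸ a) % suc p
  q = (n ∸ a) / suc p
  decompose : n ≡ a + r + q * suc p
  decompose = begin
    n                    ≡⟨ sym (m+[n∸m]≡n a≤n) ⟩
    a + (n ∸ a)          ≡⟨ cong (a +_) (m≡m%n+[m/n]*n (n ∸ a) (suc p)) ⟩
    a + (r + q * suc p)  ≡⟨ sym (+-assoc a r (q * suc p)) ⟩
    a + r + q * suc p    ∎

periodic-dichotomy : ∀ {s : ℕ → Bool} → EventuallyPeriodic s →
  (Σ ℕ λ k → BoundedGaps k s) ⊎ EventuallyFalse s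
periodic-dichotomy {s} (a , p , periodic)
  with anyUpTo? (λ d → s (a + d) ≟ᵇ true) (suc p)
... | yes (d , _ , sd) = inj₁ (_ , periodic-bounded periodic (m≤m+n a d) sd)
... | no no-true       = inj₂ (a , periodic-false periodic first-period)
  where
  first-period : ∀ d → d < suc p → s (a + d) ≡ false
  first-period d d<P = ¬-not λ sd → no-true (d , d<P , sd)

-- On a constant input the states of a finite transition system evolve
-- autonomously, so each output stream of a finite-state strategy is
-- eventually periodic.
constant-input-periodic : ∀ {I O} {f : Strategy I O} (T : FiniteTS I O) →
  Generates T f → (e : I → Bool) (b : O) →
  EventuallyPeriodic (λ n → computation f (λ _ → e) n (inj₂ b))
constant-input-periodic T generates e b =
  periodic-map (λ state → out state b) (λ n → generates (prefix input n) b)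
    (autonomous-periodic states (λ state → δ state e) states-step)
  where
  open FiniteTS T
  input : ℕ → _
  input _ = e
  states : ℕ → Fin size
  states n = run T (prefix input n)
  states-step : ∀ n → states (suc n) ≡ δ (states n) e
  states-step n = foldl-∷ʳ δ init e (prefix input n)

periodic-φₒ : ∀ w → EventuallyPeriodic (oStream w) → Σ ℕ λ k → w , k ⊨ φₒ
periodic-φₒ w periodic with periodic-dichotomy periodic
... | inj₁ (k , bounded) = k , sat-φₒ w k (inj₁ bounded)
... | inj₂ false-from    = 0 , sat-φₒ w 0 (inj₂ false-from)

noInputs : ℕ → Iₐ → Bool
noInputs _ ()

finite-not-realizes : ∀ (f : Strategy Iₐ Oₐ) → IsFiniteState f → ¬ Realizes f φₒ ⊥F
finite-not-realizes f (T , generates)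
  with periodic-φₒ (computation f noInputs)
         (constant-input-periodic T generates (noInputs 0) tt)
... | k , w⊨φ =
  not-realizes-⊥F f φₒ k (computation f noInputs) (noInputs , λ _ _ → refl) w⊨φ

-- emit n c g is the output, n steps later, of a machine with countdown c
-- and current gap g: it emits true when the countdown is zero and then
-- restarts the countdown with the gap increased by one.
emit : ℕ → ℕ → ℕ → Bool
emit zero    zero    g = true
emit zero    (suc c) g = false
emit (suc n) zero    g = emit n (suc g) (suc g)
emit (suc n) (suc c) g = emit n c g

-- true exactly at the times 0, 2, 5, 9, 14, …
growing : ℕ → Bool
growing n = emit n 0 0

countdown : ∀ c n g → emit (c + n) c g ≡ emit n 0 g
countdown zero    n g = refl
countdown (suc c) n g = countdown c n g

countdown-silent : ∀ n c g → n < c → emit n c g ≡ false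
countdown-silent zero    (suc c) g _         = refl
countdown-silent (suc n) (suc c) g (s≤s n<c) = countdown-silent n c g n<c

next-round : ∀ g n → emit (suc (suc g + n)) 0 g ≡ emit n 0 (suc g)
next-round g n = countdown (suc g) n (suc g)

emits-again : ∀ i g → Σ ℕ λ j → i ≤ j × emit j 0 g ≡ true
emits-again zero    g = 0 , z≤n , refl
emits-again (suc i) g with emits-again i (suc g)
... | j , i≤j , emitted =
  suc (suc g + j) , s≤s (≤-trans i≤j (m≤n+m j (suc g))) , trans (next-round g j) emitted

reach-round : ∀ g → Σ ℕ λ t → ∀ n → growing (t + n) ≡ emit n 0 g
reach-round zero    = 0 , λ n → refl
reach-round (suc g) with reach-round g
... | t , at-t = t + suc (suc g) , λ n → begin
  growing (t + suc (suc g) + n)    ≡⟨ cong growing (+-assoc t (suc (suc g)) n) ⟩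
  growing (t + (suc (suc g) + n))  ≡⟨ at-t (suc (suc g) + n) ⟩
  emit (suc (suc g) + n) 0 g       ≡⟨ next-round g n ⟩
  emit n 0 (suc g)                 ∎
  where open ≡-Reasoning

growing-sparse : Sparse growing
growing-sparse = (λ i → emits-again i 0) , long-gaps
  where
  -- right after the emission opening round k come k + 1 silent steps
  long-gaps : ∀ k → Σ ℕ λ i → ∀ d → d ≤ k → growing (i + d) ≡ false
  long-gaps k with reach-round k
  ... | t , at-t = suc t , λ d d≤k →
    trans (cong growing (sym (+-suc t d)))
          (trans (at-t (suc d)) (countdown-silent d (suc k) (suc k) (s≤s d≤k)))

fGrowing : Strategy Iₐ Oₐ
fGrowing inputs _ = growing (length inputs)

length-prefix : ∀ {B : Set} (x : ℕ → B) n → length (prefix x n) ≡ n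
length-prefix x zero    = refl
length-prefix x (suc n) =
  trans (length-++ (prefix x n)) (trans (+-comm _ 1) (cong suc (length-prefix x n)))

growing-realizes : Realizes fGrowing φₒ ⊥F
growing-realizes = realizes-⊥F fGrowing φₒ λ k w (input , is-computation) w⊨φ →
  Sparse-excludes k (Sparse-resp (growing≗o w input is-computation) growing-sparse)
    (φₒ-sat w k w⊨φ)
  where
  growing≗o : ∀ w input → (∀ n a → w n a ≡ computation fGrowing input n a) →
    ∀ n → growing n ≡ oStream w n
  growing≗o w input is-computation n =
    sym (trans (is-computation n o) (cong growing (length-prefix input n)))

mainTheorem1 : Σ (Formula (AP Iₐ Oₐ)) λ φ → Σ (Formula (AP Iₐ Oₐ)) λ ψ →
    (Σ (Strategy Iₐ Oₐ) λ f → IsInfiniteState f × Realizes f φ ψ)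
    × (∀ (f : Strategy Iₐ Oₐ) → IsFiniteState f → ¬ Realizes f φ ψ)
mainTheorem1 =
  φₒ , ⊥F , (fGrowing , growing-infinite-state , growing-realizes) , finite-not-realizes
  where
  growing-infinite-state : IsInfiniteState fGrowing
  growing-infinite-state finite = finite-not-realizes fGrowing finite growing-realizes
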